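{- Let $p>2$ be prime and let $(\mathcal{L},\mathcal{Q})$ be a quadratic factor on $\mathbb{F}_p^n$. Then any atom of $(\mathcal{L},\mathcal{Q})$ has $\mathrm{VC}_2$-dimension at most $1$, i.e. it does not have $\mathrm{VC}_2$-dimension at least $2$.
   Context: A quadratic factor $(\mathcal{L},\mathcal{Q})$ consists of linearly independent vectors $r_1,\dots,r_\ell\in\mathbb{F}_p^n$ and symmetric $n\times n$ matrices $M_1,\dots,M_q$ over $\mathbb{F}_p$; its atoms are the sets $\{x: x^Tr_i=a_i\ \forall i\in[\ell],\ x^TM_jx=b_j\ \forall j\in[q]\}$ for $a_i,b_j\in\mathbb{F}_p$. A subset $Q\subseteq\mathbb{F}_p^n$ has $\mathrm{VC}_2$-dimension at least $m$ if there exist $x_i$ ($i\in[m]$), $y_j$ ($j\in[m]$), $z_S$ ($S\subseteq[m]\times[m]$) in $\mathbb{F}_p^n$ with $x_i+y_j+z_S\in Q$ iff $(i,j)\in S$. -}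

module Defs where

open import Data.Nat as ℕ using (ℕ; NonZero)
open import Data.Nat.DivMod using (_mod_)
open import Data.Fin using (Fin; toℕ; zero; suc)
open import Data.Bool using (Bool; true)
open import Data.Product using (Σ; _×_; ∃-syntax)
open import Function.Bundles using (_⇔_)
open import Relation.Binary.PropositionalEquality using (_≡_)

module Field (p : ℕ) .{{_ : NonZero p}} where

  F : Set
  F = Fin p

  0F : F
  0F = 0 mod p

  _+F_ : F → F → F
  a +F b = (toℕ a ℕ.+ toℕ b) mod p

  _*F_ : F → F → F
  a *F b = (toℕ a ℕ.* toℕ b) mod p

  sumF : (k : ℕ) → (Fin k → F) → F
  sumF ℕ.zero f = 0F
  sumF (ℕ.suc k) f = f zero +F sumF k (λ i → f (suc i))

  Vec : ℕ → Set
  Vec n = Fin n → F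

  _+V_ : ∀ {n} → Vec n → Vec n → Vec n
  (u +V v) i = u i +F v i

  dot : ∀ {n} → Vec n → Vec n → F
  dot {n} u v = sumF n (λ i → u i *F v i)

  Mat : ℕ → Set
  Mat n = Fin n → Fin n → F

  Symmetric : ∀ {n} → Mat n → Set
  Symmetric M = ∀ i j → M i j ≡ M j i

  quadForm : ∀ {n} → Mat n → Vec n → F
  quadForm {n} M x = sumF n (λ i → sumF n (λ j → x i *F (M i j *F x j)))

  LinearlyIndependent : ∀ {n ℓ} → (Fin ℓ → Vec n) → Set
  LinearlyIndependent {n} {ℓ} r =
    (c : Fin ℓ → F) →
    (∀ k → sumF ℓ (λ i → c i *F r i k) ≡ 0F) →
    ∀ i → c i ≡ 0F

  record QuadraticFactor (n ℓ q : ℕ) : Set where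
    field
      r      : Fin ℓ → Vec n
      M      : Fin q → Mat n
      r-indep : LinearlyIndependent r
      M-sym  : ∀ j → Symmetric (M j)

  Atom : ∀ {n ℓ q} → QuadraticFactor n ℓ q → (Fin ℓ → F) → (Fin q → F) → Vec n → Set
  Atom 𝒬 a b x =
    (∀ i → dot x (QuadraticFactor.r 𝒬 i) ≡ a i) ×
    (∀ j → quadForm (QuadraticFactor.M 𝒬 j) x ≡ b j)

  VC2DimAtLeast : ∀ {n} → (Vec n → Set) → ℕ → Set
  VC2DimAtLeast {n} Q m =
    Σ (Fin m → Vec n) λ x →
    Σ (Fin m → Vec n) λ y →
    Σ ((Fin m → Fin m → Bool) → Vec n) λ z →
    ∀ i j S → Q ((x i +V y j) +V z S) ⇔ (S i j ≡ true)

-- Take the cube of points x i + y j + z (S s), i, j, s ∈ {0, 1}, where S 0 is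
-- all of [2] × [2] and S 1 omits (1, 1). A function of degree at most two has
-- vanishing third differences, so its values on the four vertices with
-- i + j + s odd add up to its values on the four with i + j + s even. All
-- vertices but x 1 + y 1 + z (S 1) lie in the atom, so every linear and
-- quadratic form defining the atom takes its prescribed value on seven
-- vertices and hence also on the eighth: x 1 + y 1 + z (S 1) lies in the atom
-- although (1, 1) ∉ S 1. The polynomial identities behind this are checked on
-- natural-number representatives and then reduced modulo p.
module Submission where

open import Defs
open import Data.Nat as ℕ using (ℕ; NonZero; _<_; _+_; _*_; _%_; pred)
open import Data.Nat.Primality using (Prime)
open import Data.Nat.Properties using (+-assoc; *-suc; suc-pred; +-0-commutativeMonoid)
open import Data.Nat.DivMod using (_mod_; %-distribˡ-+; %-distribˡ-*; [m+kn]%n≡m%n; m<n⇒m%n≡m)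
open import Data.Nat.Tactic.RingSolver using (solve-∀)
open import Data.Fin using (Fin; toℕ; zero; suc)
open import Data.Fin.Patterns using (0F; 1F; 2F; 3F)
open import Data.Fin.Properties using (toℕ-injective; toℕ-fromℕ<; toℕ<n)
open import Data.Vec.Functional using (zipWith)
open import Algebra.Properties.CommutativeMonoid.Sum +-0-commutativeMonoid
  using (sum; sum-syntax; ∑-comm; sum-cong-≗)
open import Data.Bool using (Bool; true; false)
open import Data.Product using (_×_; _,_; proj₁; proj₂)
open import Function using (_∘_; Equivalence)
open import Relation.Binary.PropositionalEquality
open import Relation.Nullary using (¬_; contradiction)

Vertex : Set
Vertex = Fin 2 × Fin 2 × Fin 2

top : Vertex
top = 1F , 1F , 1F

oddVertex evenVertex : Fin 4 → Vertex
oddVertex 0F = 1F , 1F , 1F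
oddVertex 1F = 0F , 0F , 1F
oddVertex 2F = 0F , 1F , 0F
oddVertex 3F = 1F , 0F , 0F
evenVertex 0F = 0F , 1F , 1F
evenVertex 1F = 1F , 0F , 1F
evenVertex 2F = 0F , 0F , 0F
evenVertex 3F = 1F , 1F , 0F

oddVertex-suc≢top : ∀ t → oddVertex (suc t) ≢ top
oddVertex-suc≢top 0F ()
oddVertex-suc≢top 1F ()
oddVertex-suc≢top 2F ()

evenVertex≢top : ∀ t → evenVertex t ≢ top
evenVertex≢top 0F ()
evenVertex≢top 1F ()
evenVertex≢top 2F ()
evenVertex≢top 3F ()

vertex : {V : Set} → (V → V → V) → (x y z : Fin 2 → V) → Vertex → V
vertex _⊕_ x y z (i , j , s) = (x i ⊕ y j) ⊕ z s

-- φ has vanishing third differences, stated without subtraction.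
record CubeBalanced {V A : Set} (_⊕_ : V → V → V) (∑ : (Fin 4 → A) → A) (φ : V → A) : Set where
  field
    balanced : ∀ x y z → ∑ (φ ∘ vertex _⊕_ x y z ∘ oddVertex) ≡ ∑ (φ ∘ vertex _⊕_ x y z ∘ evenVertex)

open CubeBalanced

∑-cubeBalanced : ∀ {V k} {_⊕_ : V → V → V} {φ : Fin k → V → ℕ} →
  (∀ i → CubeBalanced _⊕_ sum (φ i)) → CubeBalanced _⊕_ sum (λ v → ∑[ i < k ] φ i v)
∑-cubeBalanced {k = k} {_⊕_} {φ} φ-balanced .balanced x y z = begin
  ∑[ t < 4 ] ∑[ i < k ] φ i (corner (oddVertex t))   ≡⟨ ∑-comm (λ t i → φ i (corner (oddVertex t))) ⟩
  ∑[ i < k ] ∑[ t < 4 ] φ i (corner (oddVertex t))   ≡⟨ sum-cong-≗ (λ i → φ-balanced i .balanced x y z) ⟩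
  ∑[ i < k ] ∑[ t < 4 ] φ i (corner (evenVertex t))  ≡⟨ ∑-comm (λ t i → φ i (corner (evenVertex t))) ⟨
  ∑[ t < 4 ] ∑[ i < k ] φ i (corner (evenVertex t))  ∎
  where
  open ≡-Reasoning
  corner = vertex _⊕_ x y z

module _ {n : ℕ} where

  _+ᴺ_ : (Fin n → ℕ) → (Fin n → ℕ) → Fin n → ℕ
  _+ᴺ_ = zipWith _+_

  linearℕ : (Fin n → ℕ) → (Fin n → ℕ) → ℕ
  linearℕ R W = ∑[ k < n ] (W k * R k)

  quadraticℕ : (Fin n → Fin n → ℕ) → (Fin n → ℕ) → ℕ
  quadraticℕ M W = ∑[ i < n ] ∑[ j < n ] (W i * (M i j * W j))

  scaled-coordinate-cubeBalanced : ∀ k c → CubeBalanced _+ᴺ_ sum (λ v → v k * c)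
  scaled-coordinate-cubeBalanced k c .balanced x y z =
    identity c (x 0F k) (x 1F k) (y 0F k) (y 1F k) (z 0F k) (z 1F k)
    where
    identity : ∀ c x₀ x₁ y₀ y₁ z₀ z₁ →
      let α : ℕ → ℕ → ℕ → ℕ
          α u v w = (u + v + w) * c
      in α x₁ y₁ z₁ + (α x₀ y₀ z₁ + (α x₀ y₁ z₀ + (α x₁ y₀ z₀ + 0)))
       ≡ α x₀ y₁ z₁ + (α x₁ y₀ z₁ + (α x₀ y₀ z₀ + (α x₁ y₁ z₀ + 0)))
    identity = solve-∀

  coordinate-product-cubeBalanced : ∀ i j c → CubeBalanced _+ᴺ_ sum (λ v → v i * (c * v j))
  coordinate-product-cubeBalanced i j c .balanced x y z =
    identity c (x 0F i) (x 1F i) (y 0F i) (y 1F i) (z 0F i) (z 1F i)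
               (x 0F j) (x 1F j) (y 0F j) (y 1F j) (z 0F j) (z 1F j)
    where
    identity : ∀ c x₀ x₁ y₀ y₁ z₀ z₁ x₀′ x₁′ y₀′ y₁′ z₀′ z₁′ →
      let β : ℕ → ℕ → ℕ → ℕ → ℕ → ℕ → ℕ
          β u v w u′ v′ w′ = (u + v + w) * (c * (u′ + v′ + w′))
      in β x₁ y₁ z₁ x₁′ y₁′ z₁′ + (β x₀ y₀ z₁ x₀′ y₀′ z₁′ + (β x₀ y₁ z₀ x₀′ y₁′ z₀′ + (β x₁ y₀ z₀ x₁′ y₀′ z₀′ + 0)))
       ≡ β x₀ y₁ z₁ x₀′ y₁′ z₁′ + (β x₁ y₀ z₁ x₁′ y₀′ z₁′ + (β x₀ y₀ z₀ x₀′ y₀′ z₀′ + (β x₁ y₁ z₀ x₁′ y₁′ z₀′ + 0)))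
    identity = solve-∀

  linearℕ-cubeBalanced : ∀ R → CubeBalanced _+ᴺ_ sum (linearℕ R)
  linearℕ-cubeBalanced R = ∑-cubeBalanced (λ k → scaled-coordinate-cubeBalanced k (R k))

  quadraticℕ-cubeBalanced : ∀ M → CubeBalanced _+ᴺ_ sum (quadraticℕ M)
  quadraticℕ-cubeBalanced M =
    ∑-cubeBalanced (λ i → ∑-cubeBalanced (λ j → coordinate-product-cubeBalanced i j (M i j)))

module Modulo (p : ℕ) .{{_ : NonZero p}} where
  open Field p hiding (0F)
  open ≡-Reasoning

  toℕ-mod : ∀ m → toℕ (m mod p) ≡ m % p
  toℕ-mod m = toℕ-fromℕ< _

  mod-toℕ : ∀ (u : F) → toℕ u mod p ≡ u
  mod-toℕ u = toℕ-injective (trans (toℕ-mod (toℕ u)) (m<n⇒m%n≡m (toℕ<n u)))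

  %≡%⇒mod≡mod : ∀ {m n} → m % p ≡ n % p → m mod p ≡ n mod p
  %≡%⇒mod≡mod {m} {n} eq = toℕ-injective (trans (toℕ-mod m) (trans eq (sym (toℕ-mod n))))

  mod-+-hom : ∀ {m n u v} → m mod p ≡ u → n mod p ≡ v → (m + n) mod p ≡ u +F v
  mod-+-hom {m} {n} refl refl = %≡%⇒mod≡mod (begin
    (m + n) % p                                  ≡⟨ %-distribˡ-+ m n p ⟩
    (m % p + n % p) % p                          ≡⟨ cong₂ (λ a b → (a + b) % p) (toℕ-mod m) (toℕ-mod n) ⟨
    (toℕ (m mod p) + toℕ (n mod p)) % p          ∎)

  mod-*-hom : ∀ {m n u v} → m mod p ≡ u → n mod p ≡ v → (m * n) mod p ≡ u *F v
  mod-*-hom {m} {n} refl refl = %≡%⇒mod≡mod (begin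
    (m * n) % p                                  ≡⟨ %-distribˡ-* m n p ⟩
    (m % p * (n % p)) % p                        ≡⟨ cong₂ (λ a b → (a * b) % p) (toℕ-mod m) (toℕ-mod n) ⟨
    (toℕ (m mod p) * toℕ (n mod p)) % p          ∎)

  -- Adding k = toℕ w · (p - 1) turns toℕ w into a multiple of p.
  +F-cancelʳ : ∀ {u v w : F} → u +F w ≡ v +F w → u ≡ v
  +F-cancelʳ {u} {v} {w} eq = begin
    u                                   ≡⟨ absorb u ⟨
    (toℕ u + toℕ w + k) mod p           ≡⟨ mod-+-hom (mod-+-hom (mod-toℕ u) (mod-toℕ w)) refl ⟩
    (u +F w) +F (k mod p)               ≡⟨ cong (_+F (k mod p)) eq ⟩
    (v +F w) +F (k mod p)               ≡⟨ mod-+-hom (mod-+-hom (mod-toℕ v) (mod-toℕ w)) refl ⟨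
    (toℕ v + toℕ w + k) mod p           ≡⟨ absorb v ⟩
    v                                   ∎
    where
    k = toℕ w * pred p
    absorb : ∀ t → (toℕ t + toℕ w + k) mod p ≡ t
    absorb t = trans (%≡%⇒mod≡mod (trans (cong (_% p) w+k≡w*p) ([m+kn]%n≡m%n (toℕ t) (toℕ w) p)))
                     (mod-toℕ t)
      where
      w+k≡w*p : toℕ t + toℕ w + k ≡ toℕ t + toℕ w * p
      w+k≡w*p = trans (+-assoc (toℕ t) (toℕ w) k)
                      (cong (toℕ t +_) (trans (sym (*-suc (toℕ w) (pred p))) (cong (toℕ w *_) (suc-pred p))))

  sumF-cong : ∀ k {f g : Fin k → F} → (∀ i → f i ≡ g i) → sumF k f ≡ sumF k g
  sumF-cong ℕ.zero    f≡g = refl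
  sumF-cong (ℕ.suc k) f≡g = cong₂ _+F_ (f≡g zero) (sumF-cong k (f≡g ∘ suc))

  sumF-mod : ∀ k {f : Fin k → F} {g : Fin k → ℕ} →
    (∀ i → g i mod p ≡ f i) → (∑[ i < k ] g i) mod p ≡ sumF k f
  sumF-mod ℕ.zero    g≡f = refl
  sumF-mod (ℕ.suc k) g≡f = mod-+-hom (g≡f zero) (sumF-mod k (g≡f ∘ suc))

  _represents_ : ∀ {n} → (Fin n → ℕ) → Vec n → Set
  W represents w = ∀ k → W k mod p ≡ w k

  toℕ-represents : ∀ {n} (w : Vec n) → (toℕ ∘ w) represents w
  toℕ-represents w = mod-toℕ ∘ w

  +-represents : ∀ {n} {U W : Fin n → ℕ} {u w} →
    U represents u → W represents w → (U +ᴺ W) represents (u +V w)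
  +-represents U≡u W≡w k = mod-+-hom (U≡u k) (W≡w k)

  dot-represents : ∀ {n} (r : Vec n) {W w} →
    W represents w → linearℕ (toℕ ∘ r) W mod p ≡ dot w r
  dot-represents {n} r W≡w = sumF-mod n (λ k → mod-*-hom (W≡w k) (mod-toℕ (r k)))

  quadForm-represents : ∀ {n} (M : Mat n) {W w} →
    W represents w → quadraticℕ (λ i j → toℕ (M i j)) W mod p ≡ quadForm M w
  quadForm-represents {n} M W≡w =
    sumF-mod n (λ i → sumF-mod n (λ j → mod-*-hom (W≡w i) (mod-*-hom (mod-toℕ (M i j)) (W≡w j))))

  cubeBalanced-mod : ∀ {n} {ψ : (Fin n → ℕ) → ℕ} {φ : Vec n → F} →
    CubeBalanced _+ᴺ_ sum ψ → (∀ {W w} → W represents w → ψ W mod p ≡ φ w) →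
    CubeBalanced _+V_ (sumF 4) φ
  cubeBalanced-mod {ψ = ψ} {φ} ψ-balanced ψ≡φ .balanced x y z = begin
    sumF 4 (φ ∘ corner ∘ oddVertex)                ≡⟨ sumF-mod 4 (ψ≡φ ∘ corner-represents ∘ oddVertex) ⟨
    (∑[ t < 4 ] ψ (cornerℕ (oddVertex t))) mod p   ≡⟨ cong (_mod p) (ψ-balanced .balanced X Y Z) ⟩
    (∑[ t < 4 ] ψ (cornerℕ (evenVertex t))) mod p  ≡⟨ sumF-mod 4 (ψ≡φ ∘ corner-represents ∘ evenVertex) ⟩
    sumF 4 (φ ∘ corner ∘ evenVertex)               ∎
    where
    X Y Z : Fin 2 → Fin _ → ℕ
    X i = toℕ ∘ x i
    Y j = toℕ ∘ y j
    Z s = toℕ ∘ z s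
    corner = vertex _+V_ x y z
    cornerℕ = vertex _+ᴺ_ X Y Z
    corner-represents : ∀ v → cornerℕ v represents corner v
    corner-represents (i , j , s) =
      +-represents (+-represents (toℕ-represents (x i)) (toℕ-represents (y j))) (toℕ-represents (z s))

  dot-cubeBalanced : ∀ {n} (r : Vec n) → CubeBalanced _+V_ (sumF 4) (λ w → dot w r)
  dot-cubeBalanced r = cubeBalanced-mod (linearℕ-cubeBalanced (toℕ ∘ r)) (dot-represents r)

  quadForm-cubeBalanced : ∀ {n} (M : Mat n) → CubeBalanced _+V_ (sumF 4) (quadForm M)
  quadForm-cubeBalanced M =
    cubeBalanced-mod (quadraticℕ-cubeBalanced (λ i j → toℕ (M i j))) (quadForm-represents M)

  cubeBalanced-top : ∀ {V} {_⊕_ : V → V → V} {φ : V → F} {c} →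
    CubeBalanced _⊕_ (sumF 4) φ → ∀ x y z →
    (∀ v → v ≢ top → φ (vertex _⊕_ x y z v) ≡ c) → φ (vertex _⊕_ x y z top) ≡ c
  cubeBalanced-top {_⊕_ = _⊕_} {φ} {c} φ-balanced x y z others = +F-cancelʳ (begin
    φ (corner top) +F sumF 3 (λ _ → c)  ≡⟨ cong (φ (corner top) +F_) (sumF-cong 3 odd-others) ⟨
    sumF 4 (φ ∘ corner ∘ oddVertex)     ≡⟨ φ-balanced .balanced x y z ⟩
    sumF 4 (φ ∘ corner ∘ evenVertex)    ≡⟨ sumF-cong 4 (λ t → others (evenVertex t) (evenVertex≢top t)) ⟩
    sumF 4 (λ _ → c)                    ∎)
    where
    corner = vertex _⊕_ x y z
    odd-others : ∀ t → φ (corner (oddVertex (suc t))) ≡ c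
    odd-others t = others (oddVertex (suc t)) (oddVertex-suc≢top t)

  atom-top : ∀ {n ℓ q} (𝒬 : QuadraticFactor n ℓ q) a b x y z →
    (∀ v → v ≢ top → Atom 𝒬 a b (vertex _+V_ x y z v)) → Atom 𝒬 a b (vertex _+V_ x y z top)
  atom-top 𝒬 a b x y z others =
    (λ l → cubeBalanced-top (dot-cubeBalanced (r l)) x y z (λ v v≢top → proj₁ (others v v≢top) l)) ,
    (λ j → cubeBalanced-top (quadForm-cubeBalanced (M j)) x y z (λ v v≢top → proj₂ (others v v≢top) j))
    where open QuadraticFactor 𝒬

lemma3p10 : (p : ℕ) .{{_ : NonZero p}} → Prime p → 2 < p →
    (n ℓ q : ℕ) (𝒬 : Field.QuadraticFactor p n ℓ q) →
    (a : Fin ℓ → Field.F p) (b : Fin q → Field.F p) →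
    ¬ Field.VC2DimAtLeast p (Field.Atom p 𝒬 a b) 2
lemma3p10 p _ _ n ℓ q 𝒬 a b (x , y , z , shatters) =
  top∉S₁ (Equivalence.to (shatters 1F 1F (S 1F)) (atom-top 𝒬 a b x y (z ∘ S) in-atom))
  where
  open Modulo p using (atom-top)
  S : Fin 2 → Fin 2 → Fin 2 → Bool
  S 1F 1F 1F = false
  S _  _  _  = true
  top∉S₁ : S 1F 1F 1F ≢ true
  top∉S₁ ()
  S-true : ∀ i j s → (i , j , s) ≢ top → S s i j ≡ true
  S-true _  _  0F _     = refl
  S-true 0F _  1F _     = refl
  S-true 1F 0F 1F _     = refl
  S-true 1F 1F 1F v≢top = contradiction refl v≢top
  in-atom : ∀ v → v ≢ top → Field.Atom p 𝒬 a b (vertex (Field._+V_ p) x y (z ∘ S) v)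
  in-atom (i , j , s) v≢top = Equivalence.from (shatters i j (S s)) (S-true i j s v≢top)
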